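{- Let $p$ be an odd prime. Then $p$ is rogue of the $1^{\text{st}}$ kind if and only if $p$ is rogue of the $2^{\text{nd}}$ kind.
   Context: For an odd prime $p$ and $i\in\{1,2\}$, let $A_i^p=(\mathbb{Z}/p\mathbb{Z})^\times\setminus\{(-1)^i \bmod p\}$. For $g\in A_i^p$ define $u_1=g$ and $u_n=2u_{n-1}+(-1)^{i+1}$ in $\mathbb{Z}/p\mathbb{Z}$ for $n>1$; let $g_k^i=\min(\{n\in\mathbb{N}: u_n=0\}\cup\{\infty\})$, and call $\langle g\rangle_i^p=(u_n)_{1\le n<g_k^i}$ the rogue sequence of $g$. A rogue sequence which is periodic (equivalently, never reaches $0$) is called a rogue loop. The prime $p$ is rogue of the $i^{\text{th}}$ kind if there exists $g\in A_i^p$ such that $\langle g\rangle_i^p$ is a rogue loop. -}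

module Defs where

open import Data.Nat using (ℕ; zero; suc; _+_; _*_; _∸_; _<_; _≤_; NonZero)
open import Data.Nat.DivMod using (_%_)
open import Data.Product using (Σ; _×_; ∃)
open import Relation.Binary.PropositionalEquality using (_≡_; _≢_)

data Kind : Set where
  first second : Kind

-- Elements of ℤ/pℤ are represented by their canonical residues 0,…,p-1.

-- (-1)^i mod p  (the element removed from the units to form A_i^p)
excluded : Kind → (p : ℕ) → ℕ
excluded first  p = p ∸ 1   -- (-1)^1 = -1 ≡ p-1
excluded second p = 1

-- (-1)^(i+1) mod p  (the additive constant of the recurrence)
constant : Kind → (p : ℕ) → ℕ
constant first  p = 1
constant second p = p ∸ 1   -- (-1)^3 = -1 ≡ p-1

-- g ∈ A_i^p = (ℤ/pℤ)^× ∖ {(-1)^i mod p}   (p prime, so units = nonzero residues)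
InA : Kind → (p : ℕ) → ℕ → Set
InA i p g = g < p × g ≢ 0 × g ≢ excluded i p

-- u i p g n  is  u_n  (for n ≥ 1); u_1 = g, u_n = 2 u_{n-1} + (-1)^{i+1} in ℤ/pℤ.
-- The value at index 0 is an unused dummy (set to g).
u : Kind → (p : ℕ) → .{{NonZero p}} → ℕ → ℕ → ℕ
u i p g zero          = g
u i p g (suc zero)    = g
u i p g (suc (suc n)) = (2 * u i p g (suc n) + constant i p) % p

-- ⟨g⟩_i^p is a rogue loop: g_k^i = ∞, i.e. u_n ≠ 0 for every n ≥ 1.
RogueLoop : Kind → (p : ℕ) → .{{NonZero p}} → ℕ → Set
RogueLoop i p g = (n : ℕ) → 1 ≤ n → u i p g n ≢ 0

Rogue : Kind → (p : ℕ) → .{{NonZero p}} → Set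
Rogue i p = Σ ℕ λ g → InA i p g × RogueLoop i p g

module Submission where

-- Negation x ↦ p − x on residues swaps −1 and 1, so it maps A₁ᵖ onto A₂ᵖ, and it conjugates
-- x ↦ 2x + 1 into x ↦ 2x − 1.  Hence it sends the rogue sequence of g of the first kind term by
-- term to the rogue sequence of −g of the second kind, and one reaches 0 exactly when the other
-- does.

open import Defs
open import Data.Nat using (ℕ; NonZero; zero; suc; _+_; _*_; _∸_; _<_; _≤_; >-nonZero⁻¹)
open import Data.Nat.Divisibility using (_∣_)
open import Data.Nat.Primality using (Prime)
open import Data.Nat.Properties
open import Data.Nat.DivMod using (_%_; m%n<n; n%n≡0; m<n⇒m%n≡m; [m+n]%n≡m%n; %-distribˡ-+; %-distribˡ-*)
open import Data.Nat.Solver using (module +-*-Solver)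
open import Data.Product using (_,_)
open import Function.Bundles using (_⇔_; mk⇔; Equivalence)
open import Relation.Nullary using (¬_)
open import Relation.Binary.PropositionalEquality
open +-*-Solver using (solve; _:+_; _:*_; _:=_; con)

module _ {p : ℕ} .{{_ : NonZero p}} where

  u<p : ∀ i {g} → g < p → ∀ n → u i p g n < p
  u<p i g<p zero              = g<p
  u<p i g<p (suc zero)        = g<p
  u<p i {g} g<p (suc (suc n)) = m%n<n (2 * u i p g (suc n) + constant i p) p

  p∸g<p : ∀ {g} → g ≢ 0 → g < p → p ∸ g < p
  p∸g<p g≢0 g<p = ∸-monoʳ-< (n≢0⇒n>0 g≢0) (<⇒≤ g<p)

  p∸g≢0 : ∀ {g} → g < p → p ∸ g ≢ 0
  p∸g≢0 g<p p∸g≡0 = <⇒≱ g<p (m∸n≡0⇒m≤n p∸g≡0)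

  -- −(2x + 1) = 2(−x) − 1 in ℤ/pℤ.
  doubling-steps-negate : ∀ x y → (x + y) % p ≡ 0 →
    ((2 * x + constant first p) % p + (2 * y + constant second p) % p) % p ≡ 0
  doubling-steps-negate x y x+y≡0 = begin
    ((2 * x + 1) % p + (2 * y + (p ∸ 1)) % p) % p ≡⟨ %-distribˡ-+ (2 * x + 1) _ p ⟨
    ((2 * x + 1) + (2 * y + (p ∸ 1))) % p         ≡⟨ cong (_% p) regroup ⟩
    (2 * (x + y) + p) % p                         ≡⟨ [m+n]%n≡m%n (2 * (x + y)) p ⟩
    (2 * (x + y)) % p                             ≡⟨ %-distribˡ-* 2 (x + y) p ⟩
    (2 % p * ((x + y) % p)) % p                   ≡⟨ cong (λ r → (2 % p * r) % p) x+y≡0 ⟩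
    (2 % p * 0) % p                               ≡⟨ cong (_% p) (*-zeroʳ (2 % p)) ⟩
    0 % p                                         ≡⟨ m<n⇒m%n≡m (>-nonZero⁻¹ p) ⟩
    0                                             ∎
    where
    open ≡-Reasoning
    regroup : (2 * x + 1) + (2 * y + (p ∸ 1)) ≡ 2 * (x + y) + p
    regroup = begin
      (2 * x + 1) + (2 * y + (p ∸ 1)) ≡⟨ solve 3 (λ x y r → (con 2 :* x :+ con 1) :+ (con 2 :* y :+ r)
                                                    := con 2 :* (x :+ y) :+ (con 1 :+ r)) refl x y (p ∸ 1) ⟩
      2 * (x + y) + suc (p ∸ 1)       ≡⟨ cong (2 * (x + y) +_) (suc-pred p) ⟩
      2 * (x + y) + p                 ∎

  rogue-sequences-negate : ∀ {g} → g ≤ p → ∀ n → (u first p g n + u second p (p ∸ g) n) % p ≡ 0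
  rogue-sequences-negate g≤p zero          = trans (cong (_% p) (m+[n∸m]≡n g≤p)) (n%n≡0 p)
  rogue-sequences-negate g≤p (suc zero)    = rogue-sequences-negate g≤p zero
  rogue-sequences-negate {g} g≤p (suc (suc n)) =
    doubling-steps-negate (u first p g (suc n)) _ (rogue-sequences-negate g≤p (suc n))

  [a+b]%p≡0⇒[a≡0⇔b≡0] : ∀ {a b} → a < p → b < p → (a + b) % p ≡ 0 → (a ≡ 0 ⇔ b ≡ 0)
  [a+b]%p≡0⇒[a≡0⇔b≡0] {a} {b} a<p b<p a+b≡0 = mk⇔
    (λ { refl → trans (sym (m<n⇒m%n≡m b<p)) a+b≡0 })
    (λ { refl → trans (sym (m<n⇒m%n≡m a<p)) (trans (cong (_% p) (sym (+-identityʳ a))) a+b≡0) })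

  RogueLoop-first⇔RogueLoop-second-negated : ∀ {g} → g ≢ 0 → g < p →
    RogueLoop first p g ⇔ RogueLoop second p (p ∸ g)
  RogueLoop-first⇔RogueLoop-second-negated {g} g≢0 g<p = mk⇔
    (λ loop n 1≤n uₙ≡0 → loop n 1≤n (Equivalence.from (zero-iff n) uₙ≡0))
    (λ loop n 1≤n uₙ≡0 → loop n 1≤n (Equivalence.to (zero-iff n) uₙ≡0))
    where
    zero-iff : ∀ n → u first p g n ≡ 0 ⇔ u second p (p ∸ g) n ≡ 0
    zero-iff n = [a+b]%p≡0⇒[a≡0⇔b≡0] (u<p first g<p n) (u<p second (p∸g<p g≢0 g<p) n)
                   (rogue-sequences-negate (<⇒≤ g<p) n)

  InA-first⇒InA-second-negated : ∀ {g} → InA first p g → InA second p (p ∸ g)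
  InA-first⇒InA-second-negated (g<p , g≢0 , g≢p∸1) =
    p∸g<p g≢0 g<p , p∸g≢0 g<p ,
    λ p∸g≡1 → g≢p∸1 (trans (sym (m∸[m∸n]≡n (<⇒≤ g<p))) (cong (p ∸_) p∸g≡1))

  InA-second⇒InA-first-negated : ∀ {h} → InA second p h → InA first p (p ∸ h)
  InA-second⇒InA-first-negated (h<p , h≢0 , h≢1) =
    p∸g<p h≢0 h<p , p∸g≢0 h<p ,
    λ p∸h≡p∸1 → h≢1 (∸-cancelˡ-≡ (<⇒≤ h<p) (>-nonZero⁻¹ p) p∸h≡p∸1)

mainTheorem3 : (p : ℕ) → .{{_ : NonZero p}} → Prime p → ¬ (2 ∣ p) →
    (Rogue first p ⇔ Rogue second p)
mainTheorem3 p _ _ = mk⇔ to from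
  where
  to : Rogue first p → Rogue second p
  to (g , g∈A₁@(g<p , g≢0 , _) , loop) =
    p ∸ g , InA-first⇒InA-second-negated g∈A₁ ,
    Equivalence.to (RogueLoop-first⇔RogueLoop-second-negated g≢0 g<p) loop

  from : Rogue second p → Rogue first p
  from (h , h∈A₂@(h<p , h≢0 , _) , loop) =
    p ∸ h , InA-second⇒InA-first-negated h∈A₂ ,
    Equivalence.from (RogueLoop-first⇔RogueLoop-second-negated (p∸g≢0 h<p) (p∸g<p h≢0 h<p))
      (subst (RogueLoop second p) (sym (m∸[m∸n]≡n (<⇒≤ h<p))) loop)
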